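{- Let $p=2^m+1$ be a prime Fermat number ($m$ a power of $2$), and let $g$ be a primitive root modulo $p$. For $k\in\{0,1,\ldots,m-1\}$ and $t\in\mathbb{Z}_{2^m}$, let $N_{k,t}$ denote the number of pairs $(c,d)$ of residues modulo $2^{m-k-1}$ satisfying $$g^{2^{k+1}c+t}+g^{2^{k+1}d+2^k+t}\equiv 1 \pmod p.$$ Then for every $k\in\{0,1,\ldots,m-1\}$ and all $t_1,t_2\in\mathbb{Z}_{2^m}$ with $t_1\equiv t_2 \pmod{2^k}$, we have $N_{k,t_1}=N_{k,t_2}$.
   Context: Since $g^{p-1}\equiv 1\pmod p$ and $p-1=2^m$, the exponents $2^{k+1}c+t$ and $2^{k+1}d+2^k+t$ are well defined modulo $2^m$ when $c,d$ are residues modulo $2^{m-k-1}$ and $t$ is a residue modulo $2^m$, so the congruence is well defined. -}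

module Defs where

open import Data.Nat using (ℕ; zero; suc; _+_; _*_; _∸_; _^_; _≤_; _<_; NonZero)
open import Data.Nat.DivMod using (_%_)
open import Data.Nat.Primality using (Prime)
open import Data.Nat.Properties using (_≟_; m^n≢0)
open import Data.Fin using (Fin; toℕ)
open import Data.List using (List; length; filter; allFin; cartesianProduct)
open import Data.Product using (_×_; _,_; ∃-syntax; proj₁; proj₂)
open import Relation.Unary using (Decidable)
open import Relation.Binary.PropositionalEquality using (_≡_; _≢_)

FermatPrime : ℕ → ℕ → Set
FermatPrime m p = p ≡ 2 ^ m + 1 × Prime p × ∃[ n ] m ≡ 2 ^ n

PrimitiveRoot : (p : ℕ) → .{{NonZero p}} → ℕ → Set
PrimitiveRoot p g =
  (g ^ (p ∸ 1)) % p ≡ 1 % p × (∀ j → 1 ≤ j → j < p ∸ 1 → (g ^ j) % p ≢ 1 % p)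

Cond : (p : ℕ) → .{{NonZero p}} → (g k t c d : ℕ) → Set
Cond p g k t c d = ((g ^ (2 ^ suc k * c + t)) + (g ^ (2 ^ suc k * d + 2 ^ k + t))) % p ≡ 1 % p

N : (m p : ℕ) → .{{NonZero p}} → (g : ℕ) → (k : ℕ) → (t : ℕ) → ℕ
N m p g k t =
  length (filter cond?
    (cartesianProduct (allFin (2 ^ (m ∸ suc k))) (allFin (2 ^ (m ∸ suc k)))))
  where
  cond? : Decidable (λ (cd : Fin (2 ^ (m ∸ suc k)) × Fin (2 ^ (m ∸ suc k))) →
                       Cond p g k t (toℕ (proj₁ cd)) (toℕ (proj₂ cd)))
  cond? (c , d) = _ ≟ _

CongMod2^ : (k a b : ℕ) → Set
CongMod2^ k a b = _%_ a (2 ^ k) {{m^n≢0 2 k}} ≡ _%_ b (2 ^ k) {{m^n≢0 2 k}}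

{-# OPTIONS --safe #-}
-- Replacing t by t + 2^k turns the congruence for (c, d) into the congruence for (d + 1, c):
-- the exponent 2^(k+1) d + 2^k + (t + 2^k) equals 2^(k+1) (d + 1) + t, and since g^(2^m) ≡ 1
-- the residue d + 1 may be reduced modulo 2^(m-k-1). The map (c, d) ↦ (d + 1, c) permutes the
-- pairs of residues, so N_{k,t+2^k} = N_{k,t}, and N_{k,t} depends only on t mod 2^k.
module Submission where

open import Defs
open import Data.Bool using (if_then_else_)
open import Data.Fin using (Fin; zero; suc; toℕ; fromℕ<; fromℕ; inject₁)
open import Data.Fin.Properties using (toℕ-fromℕ<; toℕ-inject₁; toℕ-fromℕ; toℕ-injective; toℕ<n)
open import Data.List using (List; []; _∷_; _++_; map; length; filter; allFin; tabulate; cartesianProduct)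
open import Data.List.Properties using (map-++; map-∘; map-cong; map-tabulate)
open import Data.Nat.ListAction using (sum)
open import Data.Nat.ListAction.Properties using (sum-++)
open import Data.Nat using (ℕ; zero; suc; _+_; _*_; _∸_; _^_; _<_; NonZero; s≤s)
open import Data.Nat.DivMod
open import Data.Nat.Properties
open import Data.Nat.Solver using (module +-*-Solver)
open import Data.Product using (_×_; _,_; proj₁; proj₂)
open import Relation.Nullary using (Dec; does; yes; no)
open import Relation.Unary using (Decidable)
open import Relation.Binary.PropositionalEquality
open import Algebra.Properties.CommutativeMonoid.Sum +-0-commutativeMonoid
  using (sum-syntax; ∑-comm; sum-init-last; sum-cong-≗)
  renaming (sum to ∑)

open +-*-Solver
open ≡-Reasoning

indicator : ∀ {ℓ} {P : Set ℓ} → Dec P → ℕ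
indicator P? = if does P? then 1 else 0

length-filter≡sum-indicator : ∀ {a ℓ} {A : Set a} {P : A → Set ℓ} (P? : Decidable P) (xs : List A) →
  length (filter P? xs) ≡ sum (map (λ x → indicator (P? x)) xs)
length-filter≡sum-indicator P? [] = refl
length-filter≡sum-indicator P? (x ∷ xs) with P? x
... | yes _ = cong suc (length-filter≡sum-indicator P? xs)
... | no _  = length-filter≡sum-indicator P? xs

sum-tabulate : ∀ n (h : Fin n → ℕ) → sum (tabulate h) ≡ ∑ h
sum-tabulate zero    h = refl
sum-tabulate (suc n) h = cong (h zero +_) (sum-tabulate n (λ i → h (suc i)))

sum-map-allFin : ∀ n (f : Fin n → ℕ) → sum (map f (allFin n)) ≡ ∑ f
sum-map-allFin n f = trans (cong sum (map-tabulate (λ i → i) f)) (sum-tabulate n f)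

sum-map-cartesianProduct : ∀ {a b} {A : Set a} {B : Set b} (h : A × B → ℕ) (xs : List A) (ys : List B) →
  sum (map h (cartesianProduct xs ys)) ≡ sum (map (λ x → sum (map (λ y → h (x , y)) ys)) xs)
sum-map-cartesianProduct h []       ys = refl
sum-map-cartesianProduct h (x ∷ xs) ys = begin
  sum (map h (map (x ,_) ys ++ cartesianProduct xs ys))
    ≡⟨ cong sum (map-++ h (map (x ,_) ys) (cartesianProduct xs ys)) ⟩
  sum (map h (map (x ,_) ys) ++ map h (cartesianProduct xs ys))
    ≡⟨ sum-++ (map h (map (x ,_) ys)) _ ⟩
  sum (map h (map (x ,_) ys)) + sum (map h (cartesianProduct xs ys))
    ≡⟨ cong₂ _+_ (cong sum (sym (map-∘ ys))) (sum-map-cartesianProduct h xs ys) ⟩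
  sum (map (λ y → h (x , y)) ys) + sum (map (λ x → sum (map (λ y → h (x , y)) ys)) xs) ∎

count-allFin-pairs : ∀ {ℓ} {m n} {P : Fin m × Fin n → Set ℓ} (P? : Decidable P) →
  length (filter P? (cartesianProduct (allFin m) (allFin n))) ≡ ∑[ i < m ] ∑[ j < n ] indicator (P? (i , j))
count-allFin-pairs {m = m} {n} P? = begin
  length (filter P? (cartesianProduct (allFin m) (allFin n)))
    ≡⟨ length-filter≡sum-indicator P? (cartesianProduct (allFin m) (allFin n)) ⟩
  sum (map (λ ij → indicator (P? ij)) (cartesianProduct (allFin m) (allFin n)))
    ≡⟨ sum-map-cartesianProduct _ (allFin m) (allFin n) ⟩
  sum (map (λ i → sum (map (λ j → indicator (P? (i , j))) (allFin n))) (allFin m))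
    ≡⟨ cong sum (map-cong (λ i → sum-map-allFin n (λ j → indicator (P? (i , j)))) (allFin m)) ⟩
  sum (map (λ i → ∑[ j < n ] indicator (P? (i , j))) (allFin m))
    ≡⟨ sum-map-allFin m _ ⟩
  ∑[ i < m ] ∑[ j < n ] indicator (P? (i , j)) ∎

rotate : ∀ {n} .{{_ : NonZero n}} → Fin n → Fin n
rotate {n} i = fromℕ< (m%n<n (suc (toℕ i)) n)

toℕ-rotate : ∀ {n} .{{_ : NonZero n}} (i : Fin n) → toℕ (rotate i) ≡ suc (toℕ i) % n
toℕ-rotate {n} i = toℕ-fromℕ< (m%n<n (suc (toℕ i)) n)

rotate-inject₁ : ∀ {n} (i : Fin n) → rotate (inject₁ i) ≡ suc i
rotate-inject₁ {n} i = toℕ-injective (begin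
  toℕ (rotate (inject₁ i))     ≡⟨ toℕ-rotate (inject₁ i) ⟩
  suc (toℕ (inject₁ i)) % suc n ≡⟨ cong (λ x → suc x % suc n) (toℕ-inject₁ i) ⟩
  suc (toℕ i) % suc n           ≡⟨ m<n⇒m%n≡m (s≤s (toℕ<n i)) ⟩
  suc (toℕ i)                   ∎)

rotate-fromℕ : ∀ n → rotate (fromℕ n) ≡ zero
rotate-fromℕ n = toℕ-injective (begin
  toℕ (rotate (fromℕ n))     ≡⟨ toℕ-rotate (fromℕ n) ⟩
  suc (toℕ (fromℕ n)) % suc n ≡⟨ cong (λ x → suc x % suc n) (toℕ-fromℕ n) ⟩
  suc n % suc n               ≡⟨ n%n≡0 (suc n) ⟩
  0                           ∎)

∑-rotate : ∀ n .{{_ : NonZero n}} (f : Fin n → ℕ) → ∑[ i < n ] f (rotate i) ≡ ∑ f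
∑-rotate (suc n) f = begin
  ∑[ i < suc n ] f (rotate i)
    ≡⟨ sum-init-last (λ i → f (rotate i)) ⟩
  ∑[ i < n ] f (rotate (inject₁ i)) + f (rotate (fromℕ n))
    ≡⟨ cong₂ _+_ (sum-cong-≗ (λ i → cong f (rotate-inject₁ i))) (cong f (rotate-fromℕ n)) ⟩
  ∑[ i < n ] f (suc i) + f zero
    ≡⟨ +-comm _ (f zero) ⟩
  ∑ f ∎

∑∑-rotate-swap : ∀ n .{{_ : NonZero n}} (f h : Fin n → Fin n → ℕ) → (∀ i j → f i j ≡ h (rotate j) i) →
  ∑[ i < n ] ∑[ j < n ] f i j ≡ ∑[ i < n ] ∑[ j < n ] h i j
∑∑-rotate-swap n f h f≡h = begin
  ∑[ i < n ] ∑[ j < n ] f i j          ≡⟨ sum-cong-≗ (λ i → sum-cong-≗ (f≡h i)) ⟩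
  ∑[ i < n ] ∑[ j < n ] h (rotate j) i ≡⟨ ∑-comm (λ i j → h (rotate j) i) ⟩
  ∑[ j < n ] ∑[ i < n ] h (rotate j) i ≡⟨ ∑-rotate n (λ j → ∑[ i < n ] h j i) ⟩
  ∑[ j < n ] ∑[ i < n ] h j i          ∎

%-congʳ-* : ∀ x {y z} p .{{_ : NonZero p}} → y % p ≡ z % p → (x * y) % p ≡ (x * z) % p
%-congʳ-* x {y} {z} p y≡z = begin
  (x * y) % p               ≡⟨ %-distribˡ-* x y p ⟩
  ((x % p) * (y % p)) % p   ≡⟨ cong (λ v → ((x % p) * v) % p) y≡z ⟩
  ((x % p) * (z % p)) % p   ≡⟨ %-distribˡ-* x z p ⟨
  (x * z) % p               ∎

%-congʳ-+ : ∀ x {y z} p .{{_ : NonZero p}} → y % p ≡ z % p → (x + y) % p ≡ (x + z) % p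
%-congʳ-+ x {y} {z} p y≡z = begin
  (x + y) % p               ≡⟨ %-distribˡ-+ x y p ⟩
  ((x % p) + (y % p)) % p   ≡⟨ cong (λ v → ((x % p) + v) % p) y≡z ⟩
  ((x % p) + (z % p)) % p   ≡⟨ %-distribˡ-+ x z p ⟨
  (x + z) % p               ∎

^-%-one : ∀ x p .{{_ : NonZero p}} → x % p ≡ 1 % p → ∀ q → x ^ q % p ≡ 1 % p
^-%-one x p x≡1 zero    = refl
^-%-one x p x≡1 (suc q) = begin
  (x * x ^ q) % p ≡⟨ %-congʳ-* x p (^-%-one x p x≡1 q) ⟩
  (x * 1) % p     ≡⟨ cong (_% p) (*-identityʳ x) ⟩
  x % p           ≡⟨ x≡1 ⟩
  1 % p           ∎

^-%-period : ∀ g P p .{{_ : NonZero p}} → g ^ P % p ≡ 1 % p → ∀ e q → g ^ (e + P * q) % p ≡ g ^ e % p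
^-%-period g P p g^P≡1 e q = begin
  g ^ (e + P * q) % p       ≡⟨ cong (_% p) (^-distribˡ-+-* g e (P * q)) ⟩
  (g ^ e * g ^ (P * q)) % p ≡⟨ cong (λ v → (g ^ e * v) % p) (^-*-assoc g P q) ⟨
  (g ^ e * (g ^ P) ^ q) % p ≡⟨ %-congʳ-* (g ^ e) p (^-%-one (g ^ P) p g^P≡1 q) ⟩
  (g ^ e * 1) % p           ≡⟨ cong (_% p) (*-identityʳ (g ^ e)) ⟩
  g ^ e % p                 ∎

^-%-exponent-mod : ∀ g a M .{{_ : NonZero M}} p .{{_ : NonZero p}} → g ^ (a * M) % p ≡ 1 % p →
  ∀ x t → g ^ (a * x + t) % p ≡ g ^ (a * (x % M) + t) % p
^-%-exponent-mod g a M p g^aM≡1 x t = begin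
  g ^ (a * x + t) % p
    ≡⟨ cong (λ y → g ^ (a * y + t) % p) (m≡m%n+[m/n]*n x M) ⟩
  g ^ (a * (x % M + x / M * M) + t) % p
    ≡⟨ cong (λ y → g ^ y % p)
         (solve 5 (λ a r q M t → a :* (r :+ q :* M) :+ t := (a :* r :+ t) :+ (a :* M) :* q)
                refl a (x % M) (x / M) M t) ⟩
  g ^ (a * (x % M) + t + a * M * (x / M)) % p
    ≡⟨ ^-%-period g (a * M) p g^aM≡1 (a * (x % M) + t) (x / M) ⟩
  g ^ (a * (x % M) + t) % p ∎

Cond-lhs : (p : ℕ) → .{{_ : NonZero p}} → (g k t c d : ℕ) → ℕ
Cond-lhs p g k t c d = ((g ^ (2 ^ suc k * c + t)) + (g ^ (2 ^ suc k * d + 2 ^ k + t))) % p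

module _ (m p : ℕ) .{{_ : NonZero p}} (g : ℕ) (g^2^m≡1 : g ^ (2 ^ m) % p ≡ 1 % p) (k : ℕ) (k<m : k < m) where

  private
    M : ℕ
    M = 2 ^ (m ∸ suc k)

    instance
      M≢0 : NonZero M
      M≢0 = m^n≢0 2 (m ∸ suc k)

      2^k≢0 : NonZero (2 ^ k)
      2^k≢0 = m^n≢0 2 k

    g^[2^[k+1]*M]≡1 : g ^ (2 ^ suc k * M) % p ≡ 1 % p
    g^[2^[k+1]*M]≡1 = subst (λ e → g ^ e % p ≡ 1 % p)
      (trans (cong (2 ^_) (sym (m+[n∸m]≡n k<m))) (^-distribˡ-+-* 2 (suc k) (m ∸ suc k))) g^2^m≡1

  Cond-lhs-shift : ∀ t c d → Cond-lhs p g k (t + 2 ^ k) c d ≡ Cond-lhs p g k t (suc d % M) c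
  Cond-lhs-shift t c d = begin
    (g ^ (2 ^ suc k * c + (t + K)) + g ^ (2 ^ suc k * d + K + (t + K))) % p
      ≡⟨ cong₂ (λ a b → (g ^ a + g ^ b) % p)
           (solve 3 (λ K c t → (con 2 :* K) :* c :+ (t :+ K) := (con 2 :* K) :* c :+ K :+ t) refl K c t)
           (solve 3 (λ K d t → (con 2 :* K) :* d :+ K :+ (t :+ K) := (con 2 :* K) :* (con 1 :+ d) :+ t) refl K d t) ⟩
    (g^c + g ^ (2 ^ suc k * suc d + t)) % p
      ≡⟨ %-congʳ-+ g^c p (^-%-exponent-mod g (2 ^ suc k) M p g^[2^[k+1]*M]≡1 (suc d) t) ⟩
    (g^c + g ^ (2 ^ suc k * (suc d % M) + t)) % p
      ≡⟨ cong (_% p) (+-comm g^c _) ⟩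
    (g ^ (2 ^ suc k * (suc d % M) + t) + g^c) % p ∎
    where
    K : ℕ
    K = 2 ^ k

    g^c : ℕ
    g^c = g ^ (2 ^ suc k * c + 2 ^ k + t)

  N≡∑∑ : ∀ t → N m p g k t ≡ ∑[ c < M ] ∑[ d < M ] indicator (Cond-lhs p g k t (toℕ c) (toℕ d) ≟ 1 % p)
  N≡∑∑ t = count-allFin-pairs {m = M} {M} (λ cd → Cond-lhs p g k t (toℕ (proj₁ cd)) (toℕ (proj₂ cd)) ≟ 1 % p)

  N-shift : ∀ t → N m p g k (t + 2 ^ k) ≡ N m p g k t
  N-shift t = begin
    N m p g k (t + 2 ^ k) ≡⟨ N≡∑∑ (t + 2 ^ k) ⟩
    _                     ≡⟨ ∑∑-rotate-swap M _ _ (λ c d →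
                               cong (λ v → indicator (v ≟ 1 % p)) (begin
                                 Cond-lhs p g k (t + 2 ^ k) (toℕ c) (toℕ d)
                                   ≡⟨ Cond-lhs-shift t (toℕ c) (toℕ d) ⟩
                                 Cond-lhs p g k t (suc (toℕ d) % M) (toℕ c)
                                   ≡⟨ cong (λ y → Cond-lhs p g k t y (toℕ c)) (toℕ-rotate d) ⟨
                                 Cond-lhs p g k t (toℕ (rotate d)) (toℕ c) ∎)) ⟩
    _                     ≡⟨ N≡∑∑ t ⟨
    N m p g k t           ∎

  N-+-multiple : ∀ t q → N m p g k (t + q * 2 ^ k) ≡ N m p g k t
  N-+-multiple t zero    = cong (N m p g k) (+-identityʳ t)
  N-+-multiple t (suc q) = begin
    N m p g k (t + (2 ^ k + q * 2 ^ k))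
      ≡⟨ cong (N m p g k) (solve 3 (λ t K Q → t :+ (K :+ Q) := (t :+ Q) :+ K) refl t (2 ^ k) (q * 2 ^ k)) ⟩
    N m p g k (t + q * 2 ^ k + 2 ^ k) ≡⟨ N-shift (t + q * 2 ^ k) ⟩
    N m p g k (t + q * 2 ^ k)         ≡⟨ N-+-multiple t q ⟩
    N m p g k t                       ∎

  N-mod : ∀ t → N m p g k t ≡ N m p g k (t % 2 ^ k)
  N-mod t = trans (cong (N m p g k) (m≡m%n+[m/n]*n t (2 ^ k))) (N-+-multiple (t % 2 ^ k) (t / 2 ^ k))

mainTheorem2 : (m p : ℕ) → .{{_ : NonZero p}} → FermatPrime m p →
    (g : ℕ) → PrimitiveRoot p g →
    (k : ℕ) → k < m → (t₁ t₂ : Fin (2 ^ m)) →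
    CongMod2^ k (toℕ t₁) (toℕ t₂) →
    N m p g k (toℕ t₁) ≡ N m p g k (toℕ t₂)
mainTheorem2 m p (p≡2^m+1 , _ , _) g (g^[p-1]≡1 , _) k k<m t₁ t₂ t₁≡t₂ = begin
  N m p g k (toℕ t₁)           ≡⟨ N-mod m p g g^2^m≡1 k k<m (toℕ t₁) ⟩
  N m p g k (toℕ t₁ % 2 ^ k)   ≡⟨ cong (N m p g k) t₁≡t₂ ⟩
  N m p g k (toℕ t₂ % 2 ^ k)   ≡⟨ N-mod m p g g^2^m≡1 k k<m (toℕ t₂) ⟨
  N m p g k (toℕ t₂)           ∎
  where
  instance
    2^k≢0 : NonZero (2 ^ k)
    2^k≢0 = m^n≢0 2 k

  g^2^m≡1 : g ^ (2 ^ m) % p ≡ 1 % p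
  g^2^m≡1 = subst (λ e → g ^ e % p ≡ 1 % p) (trans (cong (_∸ 1) p≡2^m+1) (m+n∸n≡m (2 ^ m) 1)) g^[p-1]≡1
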